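{- Let $\Gamma$ be a finite group and $t$ a positive integer such that $|\Gamma|\leq t\,(\overline{D}(\Gamma))!$. If $H$ is a subgroup of $\Gamma$ with index $[\Gamma:H]\geq t$, then $\overline{D}(H)\leq\overline{D}(\Gamma)$.
   Context: For a group $G$ acting faithfully on a set $X$, $D_G(X)$ is the least $r$ such that there is a surjection $\phi:X\to\{1,\ldots,r\}$ whose only preserving element ($g$ with $\phi(g.x)=\phi(x)$ for all $x$) is the identity. $\overline{D}(G)=\max\{D_G(X):\ G \text{ acts faithfully on } X\}$. -}

module Defs where

open import Level using (0ℓ)
open import Data.Nat using (ℕ; zero; suc; _+_; _*_; _≤_; _<_)
open import Data.Fin using (Fin)
open import Data.List using (List; map; allFin)
open import Data.Nat.ListAction using (sum)
open import Data.Bool using (Bool; true; false; T; if_then_else_)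
open import Data.Unit using (tt)
open import Data.Product using (Σ; ∃; _×_; _,_; proj₁; proj₂)
open import Relation.Nullary using (¬_)
open import Relation.Binary.PropositionalEquality using (_≡_; refl; cong; subst)
open import Function.Bundles using (_↔_; Inverse)

record Grp : Set₁ where
  field
    Carrier : Set
    _·_     : Carrier → Carrier → Carrier
    e       : Carrier
    inv     : Carrier → Carrier
    assoc   : ∀ x y z → (x · y) · z ≡ x · (y · z)
    idˡ     : ∀ x → e · x ≡ x
    idʳ     : ∀ x → x · e ≡ x
    invˡ    : ∀ x → inv x · x ≡ e
    invʳ    : ∀ x → x · inv x ≡ e

record FinGrp : Set₁ where
  field
    grp   : Grp
    order : ℕ
    enum  : Grp.Carrier grp ↔ Fin order
  open Grp grp public

record Action (G : Grp) (X : Set) : Set where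
  open Grp G
  field
    act    : Carrier → X → X
    act-e  : ∀ x → act e x ≡ x
    act-·  : ∀ g h x → act (g · h) x ≡ act g (act h x)

module _ {G : Grp} {X : Set} (A : Action G X) where
  open Grp G
  open Action A

  Faithful : Set
  Faithful = ∀ g → (∀ x → act g x ≡ x) → g ≡ e

  Preserves : ∀ {r} → (X → Fin r) → Carrier → Set
  Preserves φ g = ∀ x → φ (act g x) ≡ φ x

  Surjective : ∀ {r} → (X → Fin r) → Set
  Surjective {r} φ = ∀ (c : Fin r) → ∃ λ x → φ x ≡ c

  Distinguishing : ℕ → Set
  Distinguishing r = Σ (X → Fin r) λ φ → Surjective φ × (∀ g → Preserves φ g → g ≡ e)

  IsDistNumber : ℕ → Set
  IsDistNumber r = Distinguishing r × (∀ s → s < r → ¬ Distinguishing s)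

-- \overline{D}(G) = d : d is the maximum of D_G(X) over faithful actions of G
IsMaxDistNumber : Grp → ℕ → Set₁
IsMaxDistNumber G d =
  (Σ Set λ X → Σ (Action G X) λ A → Faithful A × IsDistNumber A d)
  × (∀ (X : Set) (A : Action G X) → Faithful A → ∀ r → IsDistNumber A r → r ≤ d)

record Subgroup (G : Grp) : Set where
  open Grp G
  field
    mem     : Carrier → Bool
    mem-e   : T (mem e)
    mem-·   : ∀ {x y} → T (mem x) → T (mem y) → T (mem (x · y))
    mem-inv : ∀ {x} → T (mem x) → T (mem (inv x))

private
  T-irr : ∀ b (p q : T b) → p ≡ q
  T-irr true tt tt = refl

  Σ-ext : ∀ {C : Set} {P : C → Bool} {a b : C} {p : T (P a)} {q : T (P b)} →
          a ≡ b → _≡_ {A = Σ C (λ c → T (P c))} (a , p) (b , q)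
  Σ-ext {P = P} {a} {p = p} {q} refl = cong (a ,_) (T-irr (P a) p q)

subGrp : (G : Grp) → Subgroup G → Grp
subGrp G H = record
  { Carrier = Σ Carrier (λ g → T (mem g))
  ; _·_   = λ x y → (proj₁ x · proj₁ y) , mem-· (proj₂ x) (proj₂ y)
  ; e     = e , mem-e
  ; inv   = λ x → inv (proj₁ x) , mem-inv (proj₂ x)
  ; assoc = λ x y z → Σ-ext (assoc (proj₁ x) (proj₁ y) (proj₁ z))
  ; idˡ   = λ x → Σ-ext (idˡ (proj₁ x))
  ; idʳ   = λ x → Σ-ext (idʳ (proj₁ x))
  ; invˡ  = λ x → Σ-ext (invˡ (proj₁ x))
  ; invʳ  = λ x → Σ-ext (invʳ (proj₁ x))
  }
  where open Grp G
        open Subgroup H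

subOrder : (Γ : FinGrp) → Subgroup (FinGrp.grp Γ) → ℕ
subOrder Γ H =
  sum (map (λ i → if Subgroup.mem H (Inverse.from (FinGrp.enum Γ) i) then 1 else 0)
           (allFin (FinGrp.order Γ)))

-- t ≤ [Γ : H], expressed (via Lagrange: |Γ| = [Γ:H]·|H|) as t·|H| ≤ |Γ|.
IndexAtLeast : (Γ : FinGrp) → Subgroup (FinGrp.grp Γ) → ℕ → Set
IndexAtLeast Γ H t = t * subOrder Γ H ≤ FinGrp.order Γ

{-# OPTIONS --safe #-}
-- The theorem reduces to the bound D_G(X)! ≤ |G| for a finite group G acting on X: if
-- D̄(H) > D̄(Γ) ≥ 1, then t·D̄(Γ)! < t·D̄(H)! ≤ t·|H| ≤ |Γ| ≤ t·D̄(Γ)!.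
--
-- The bound is an orbit–stabiliser induction: if no m-colouring distinguishes a group K,
-- then some K-orbit has more than m points, for otherwise colouring each point by its
-- position inside its orbit would distinguish K.  The stabiliser of such a point admits no
-- distinguishing (m - 1)-colouring (give the point a fresh colour), so by induction
-- |K| ≥ (m + 1)·m!.  To make "position inside an orbit" meaningful for an arbitrary X,
-- points are replaced by a natural number encoding their profile h ↦ φ(h x) under a
-- distinguishing colouring φ; this is G-equivariant and fixed pointwise only by the
-- identity.  The large orbit is only found under ¬¬, which is harmless because the
-- conclusion is a decidable inequality.
module Submission where

open import Defs
open import Data.Bool using (Bool; true; false; T; if_then_else_)
open import Data.Bool.Properties using (T?; T-irrelevant)
open import Data.Empty using (⊥-elim)
open import Data.Fin using (Fin; zero; suc; toℕ; fromℕ<; punchOut; combine; funToFin; finToFun)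
open import Data.Fin.Properties
  using (¬Fin0; toℕ<n; toℕ-injective; fromℕ<-cong; fromℕ<-injective; punchOut-injective;
         suc-injective; finToFun-funToFin)
open import Data.List
  using (List; []; _∷_; [_]; _++_; map; filter; length; lookup; downFrom; allFin)
open import Data.List.Properties using (filter-≐; filter-accept; length-++; length-map)
open import Data.List.Membership.Propositional using (_∈_)
open import Data.List.Membership.Propositional.Properties
  using (∈-map⁺; ∈-map⁻; ∈-filter⁺; ∈-filter⁻; ∈-∃++; ∈-++⁺ˡ; ∈-++⁺ʳ; ∈-++⁻; ∈-allFin)
open import Data.List.Relation.Binary.Subset.Propositional using (_⊆_)
open import Data.List.Relation.Unary.All using (All; []; _∷_; all?)
import Data.List.Relation.Unary.All as All
open import Data.List.Relation.Unary.All.Properties using (all-filter; ++⁺; map⁺)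
open import Data.List.Relation.Unary.Any using (here; there; index)
open import Data.List.Relation.Unary.Any.Properties using (lookup-index)
open import Data.List.Relation.Unary.AllPairs using (_∷_)
open import Data.List.Relation.Unary.Unique.Propositional using (Unique; [])
import Data.List.Relation.Unary.Unique.Propositional.Properties as Unique
open import Data.Nat
  using (ℕ; zero; suc; _+_; _*_; _^_; _≤_; _<_; _≤′_; ≤′-refl; ≤′-step; z≤n; s≤s; _≤?_; _!; _≟_;
         >-nonZero)
open import Data.List.Membership.DecPropositional _≟_ using (_∈?_)
open import Data.Nat.ListAction using (sum)
open import Data.Nat.Properties
  using (≤-refl; ≤-trans; <-≤-trans; <⇒≤; ≤⇒≤′; <-cmp; <-irrefl; <⇒≱; ≮⇒≥; n≤1+n; m<m+n; +-suc;
         *-mono-≤; *-monoˡ-≤; *-monoʳ-≤; *-cancelˡ-≤; 1≤n!; ≤-pred; ≰⇒>; module ≤-Reasoning)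
open import Data.Product using (Σ; ∃; _×_; _,_; proj₁; proj₂)
open import Data.Sum using (inj₁; inj₂)
open import Data.Unit using (⊤; tt)
open import Function using (_∘_)
open import Function.Bundles using (Inverse)
open import Relation.Binary.Definitions using (tri<; tri≈; tri>)
open import Relation.Binary.PropositionalEquality
  using (_≡_; refl; sym; trans; cong; cong₂; subst; module ≡-Reasoning)
open import Relation.Nullary using (¬_; Dec; yes; no)
open import Relation.Nullary.Decidable using (decidable-stable)
open import Relation.Nullary.Negation using (¬¬-map)
open import Relation.Unary using (U; Irrelevant)

!-mono-≤ : ∀ {m n} → m ≤ n → m ! ≤ n !
!-mono-≤ {zero}  {n}     _         = 1≤n! n
!-mono-≤ {suc m} {suc n} (s≤s m≤n) = *-mono-≤ (s≤s m≤n) (!-mono-≤ m≤n)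

!-mono-< : ∀ {m n} → 1 ≤ m → m < n → m ! < n !
!-mono-< {suc m} 1≤m m<n =
  <-≤-trans (m<m+n (suc m !) (*-mono-≤ {1} {suc m} {1} (s≤s z≤n) (1≤n! (suc m)))) (!-mono-≤ m<n)

¬¬-Π-Fin : ∀ {n} {Q : Fin n → Set} → (∀ j → ¬ ¬ Q j) → ¬ ¬ (∀ j → Q j)
¬¬-Π-Fin {zero}  _ k = k (λ ())
¬¬-Π-Fin {suc n} h k = h zero λ q₀ → ¬¬-Π-Fin (h ∘ suc) λ q → k λ { zero → q₀ ; (suc j) → q j }

funToFin-cong : ∀ {m n} {f g : Fin m → Fin n} → (∀ i → f i ≡ g i) → funToFin f ≡ funToFin g
funToFin-cong {zero}  _   = refl
funToFin-cong {suc m} f≗g = cong₂ combine (f≗g zero) (funToFin-cong (f≗g ∘ suc))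

funToFin-injective : ∀ {m n} {f g : Fin m → Fin n} → funToFin f ≡ funToFin g → ∀ i → f i ≡ g i
funToFin-injective {f = f} {g} eq i =
  trans (sym (finToFun-funToFin f i)) (trans (cong (λ k → finToFun k i) eq) (finToFun-funToFin g i))

AtLeast : {A : Set} → ℕ → (A → Set) → Set
AtLeast {A} n P = Σ (List A) λ L → Unique L × All P L × n ≤ length L

AtLeast-≤ : ∀ {A : Set} {P : A → Set} {m n} → m ≤ n → AtLeast n P → AtLeast m P
AtLeast-≤ m≤n (L , uL , pL , n≤|L|) = L , uL , pL , ≤-trans m≤n n≤|L|

module _ {A : Set} where

  Unique-⊆⇒length≤ : ∀ {xs ys : List A} → Unique xs → xs ⊆ ys → length xs ≤ length ys
  Unique-⊆⇒length≤ []                  _     = z≤n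
  Unique-⊆⇒length≤ {x ∷ xs} (x∉xs ∷ u) xs⊆ys with as , bs , refl ← ∈-∃++ (xs⊆ys (here refl)) =
    subst (suc (length xs) ≤_) (sym |as++x∷bs|) (s≤s (Unique-⊆⇒length≤ u xs⊆as++bs))
    where
    xs⊆as++bs : xs ⊆ as ++ bs
    xs⊆as++bs {v} v∈xs with ∈-++⁻ as (xs⊆ys (there v∈xs))
    ... | inj₁ v∈as         = ∈-++⁺ˡ v∈as
    ... | inj₂ (here refl)  = ⊥-elim (All.lookup x∉xs v∈xs refl)
    ... | inj₂ (there v∈bs) = ∈-++⁺ʳ as v∈bs
    |as++x∷bs| : length (as ++ x ∷ bs) ≡ suc (length (as ++ bs))
    |as++x∷bs| = begin
      length (as ++ x ∷ bs)       ≡⟨ length-++ as ⟩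
      length as + suc (length bs) ≡⟨ +-suc (length as) (length bs) ⟩
      suc (length as + length bs) ≡⟨ cong suc (length-++ as) ⟨
      suc (length (as ++ bs))     ∎
      where open ≡-Reasoning

  ∈-toList⁺ : ∀ {P : A → Set} {xs x} → Irrelevant P → (pxs : All P xs) → x ∈ xs →
              ∀ (p : P x) → (x , p) ∈ All.toList pxs
  ∈-toList⁺ irr (px ∷ _)   (here refl) p = here (cong (_ ,_) (irr p px))
  ∈-toList⁺ irr (_ ∷ pxs)  (there x∈)  p = there (∈-toList⁺ irr pxs x∈ p)

  sum-indicator≡length-filter : ∀ (f : A → Bool) xs →
    sum (map (λ x → if f x then 1 else 0) xs) ≡ length (filter (T? ∘ f) xs)
  sum-indicator≡length-filter f []       = refl
  sum-indicator≡length-filter f (x ∷ xs) with f x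
  ... | true  = cong suc (sum-indicator≡length-filter f xs)
  ... | false = sum-indicator≡length-filter f xs

below : List ℕ → ℕ → List ℕ
below L n = filter (_∈? L) (downFrom n)

rank : List ℕ → ℕ → ℕ
rank L n = length (below L n)

below-Unique : ∀ L n → Unique (below L n)
below-Unique L n = Unique.filter⁺ (_∈? L) (Unique.downFrom⁺ n)

below-⊆ : ∀ L n → below L n ⊆ L
below-⊆ L n = proj₂ ∘ ∈-filter⁻ (_∈? L) {xs = downFrom n}

rank-cong : ∀ {L L′} → L ⊆ L′ → L′ ⊆ L → ∀ n → rank L n ≡ rank L′ n
rank-cong L⊆L′ L′⊆L n = cong length (filter-≐ (_∈? _) (_∈? _) (L⊆L′ , L′⊆L) (downFrom n))

rank-mono : ∀ L {m n} → m ≤ n → rank L m ≤ rank L n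
rank-mono L = mono′ ∘ ≤⇒≤′
  where
  mono′ : ∀ {m n} → m ≤′ n → rank L m ≤ rank L n
  mono′ ≤′-refl = ≤-refl
  mono′ {n = suc n} (≤′-step m≤′n) with n ∈? L
  ... | yes _ = ≤-trans (mono′ m≤′n) (n≤1+n _)
  ... | no _  = mono′ m≤′n

rank-strict : ∀ {L m n} → m ∈ L → m < n → rank L m < rank L n
rank-strict {L} {m} {n} m∈L m<n =
  subst (_≤ rank L n) (cong length (filter-accept (_∈? L) m∈L)) (rank-mono L m<n)

rank-injective : ∀ {L m n} → m ∈ L → n ∈ L → rank L m ≡ rank L n → m ≡ n
rank-injective {L} {m} {n} m∈L n∈L eq with <-cmp m n
... | tri< m<n _ _ = ⊥-elim (<-irrefl eq (rank-strict m∈L m<n))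
... | tri≈ _ m≡n _ = m≡n
... | tri> _ _ n<m = ⊥-elim (<-irrefl (sym eq) (rank-strict n∈L n<m))

module _ {G : Grp} where
  open Grp G

  ·-cancelˡ : ∀ g {k k′} → g · k ≡ g · k′ → k ≡ k′
  ·-cancelˡ g {k} {k′} eq = begin
    k                ≡⟨ idˡ k ⟨
    e · k            ≡⟨ cong (_· k) (invˡ g) ⟨
    (inv g · g) · k  ≡⟨ assoc (inv g) g k ⟩
    inv g · (g · k)  ≡⟨ cong (inv g ·_) eq ⟩
    inv g · (g · k′) ≡⟨ assoc (inv g) g k′ ⟨
    (inv g · g) · k′ ≡⟨ cong (_· k′) (invˡ g) ⟩
    e · k′           ≡⟨ idˡ k′ ⟩
    k′               ∎
    where open ≡-Reasoning

  module _ {X : Set} (A : Action G X) where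
    open Action A

    act-inv-act : ∀ k x → act (inv k) (act k x) ≡ x
    act-inv-act k x = begin
      act (inv k) (act k x) ≡⟨ act-· (inv k) k x ⟨
      act (inv k · k) x     ≡⟨ cong (λ g → act g x) (invˡ k) ⟩
      act e x               ≡⟨ act-e x ⟩
      x                     ∎
      where open ≡-Reasoning

    Distinguishes : ∀ {r} → (X → Fin r) → Set
    Distinguishes φ = ∀ g → Preserves A φ g → g ≡ e

    -- A colouring that misses a colour is compressed by punching that colour out;
    -- surjectivity itself is only available under ¬¬.
    noSmallDistinguishing : ∀ {D} → (∀ s → s < D → ¬ Distinguishing A s) →
                            ∀ {s} → s < D → (c : X → Fin s) → ¬ Distinguishes c
    noSmallDistinguishing minimal {zero}  s<D c dist = minimal 0 s<D (c , (λ ()) , dist)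
    noSmallDistinguishing minimal {suc s} s<D c dist =
      ¬¬-Π-Fin hit λ surj → minimal (suc s) s<D (c , surj , dist)
      where
      hit : ∀ j → ¬ ¬ ∃ λ x → c x ≡ j
      hit j missed = noSmallDistinguishing minimal (<⇒≤ s<D) c′ dist′
        where
        c′ : X → Fin s
        c′ x = punchOut {i = j} {j = c x} (λ eq → missed (x , sym eq))
        dist′ : Distinguishes c′
        dist′ g pres = dist g λ x → punchOut-injective {i = j} _ _ (pres x)

maxDistNumber-positive : ∀ {G d} → IsMaxDistNumber G d → 1 ≤ d
maxDistNumber-positive {d = suc _} _ = s≤s z≤n
maxDistNumber-positive {G} {zero} ((X , A , faithful , (φ , _) , _) , maximal) =
  maximal ⊤ trivial (λ g _ → trivialGroup g) 1 isDist
  where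
  open Grp G
  trivialGroup : ∀ g → g ≡ e
  trivialGroup g = faithful g (λ x → ⊥-elim (¬Fin0 (φ x)))
  trivial : Action G ⊤
  trivial = record { act = λ _ x → x ; act-e = λ _ → refl ; act-· = λ _ _ _ → refl }
  isDist : IsDistNumber trivial 1
  isDist = ((λ _ → zero) , (λ { zero → tt , refl }) , (λ g _ → trivialGroup g))
         , λ { zero _ (c , _) → ¬Fin0 (c tt) ; (suc _) (s≤s ()) }

module Labelled {G : Grp} (elems : List (Grp.Carrier G)) (complete : ∀ g → g ∈ elems)
  {X : Set} (A : Action G X) (label : X → ℕ) (bound : ℕ) (label<bound : ∀ x → label x < bound)
  (label-act : ∀ g {x y} → label x ≡ label y → label (Action.act A g x) ≡ label (Action.act A g y))
  (label-faithful : ∀ g → (∀ x → label (Action.act A g x) ≡ label x) → g ≡ Grp.e G) where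
  open Grp G
  open Action A

  Stabilises : List X → Carrier → Set
  Stabilises xs k = All (λ x → label (act k x) ≡ label x) xs

  Stabilises-e : ∀ xs → Stabilises xs e
  Stabilises-e xs = All.tabulate λ {x} _ → cong label (act-e x)

  Stabilises-· : ∀ {xs g k} → Stabilises xs g → Stabilises xs k → Stabilises xs (g · k)
  Stabilises-· [] [] = []
  Stabilises-· {x ∷ _} {g} {k} (gx ∷ gs) (kx ∷ ks) =
    trans (cong label (act-· g k x)) (trans (label-act g kx) gx) ∷ Stabilises-· gs ks

  Stabilises-inv : ∀ {xs k} → Stabilises xs k → Stabilises xs (inv k)
  Stabilises-inv {k = k} = All.map λ {x} kx →
    sym (trans (sym (cong label (act-inv-act A k x))) (label-act (inv k) kx))

  stabiliser : List X → List Carrier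
  stabiliser xs = filter (λ k → all? (λ x → label (act k x) ≟ label x) xs) elems

  orbit : List X → X → List ℕ
  orbit xs x = map (λ k → label (act k x)) (stabiliser xs)

  ∈-orbit⁺ : ∀ {xs k x} → Stabilises xs k → label (act k x) ∈ orbit xs x
  ∈-orbit⁺ k∈ = ∈-map⁺ _ (∈-filter⁺ _ (complete _) k∈)

  ∈-orbit⁻ : ∀ {xs x v} → v ∈ orbit xs x → ∃ λ k → Stabilises xs k × v ≡ label (act k x)
  ∈-orbit⁻ v∈ with k , k∈ , refl ← ∈-map⁻ _ v∈ = k , proj₂ (∈-filter⁻ _ {xs = elems} k∈) , refl

  orbit-self : ∀ xs x → label x ∈ orbit xs x
  orbit-self xs x = subst (_∈ orbit xs x) (cong label (act-e x)) (∈-orbit⁺ (Stabilises-e xs))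

  orbit-⊆-act : ∀ {xs k x} → Stabilises xs k → orbit xs x ⊆ orbit xs (act k x)
  orbit-⊆-act {xs} {k} {x} k∈ v∈ with h , h∈ , refl ← ∈-orbit⁻ v∈ =
    subst (λ y → label y ∈ orbit xs (act k x)) eq (∈-orbit⁺ (Stabilises-· h∈ (Stabilises-inv k∈)))
    where
    eq : act (h · inv k) (act k x) ≡ act h x
    eq = trans (act-· h (inv k) (act k x)) (cong (act h) (act-inv-act A k x))

  act-orbit-⊆ : ∀ {xs k x} → Stabilises xs k → orbit xs (act k x) ⊆ orbit xs x
  act-orbit-⊆ {xs} {k} {x} k∈ v∈ with h , h∈ , refl ← ∈-orbit⁻ v∈ =
    subst (λ y → label y ∈ orbit xs x) (act-· h k x) (∈-orbit⁺ (Stabilises-· h∈ k∈))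

  orbit-cong : ∀ {xs x y} → label x ≡ label y → orbit xs x ⊆ orbit xs y
  orbit-cong {xs} {y = y} x~y v∈ with h , h∈ , refl ← ∈-orbit⁻ v∈ =
    subst (_∈ orbit xs y) (sym (label-act h x~y)) (∈-orbit⁺ h∈)

  orbitSize : List X → X → ℕ
  orbitSize xs x = rank (orbit xs x) bound

  orbitRank : List X → X → ℕ
  orbitRank xs x = rank (orbit xs x) (label x)

  orbitRank<orbitSize : ∀ xs x → orbitRank xs x < orbitSize xs x
  orbitRank<orbitSize xs x = rank-strict (orbit-self xs x) (label<bound x)

  orbitRank-cong : ∀ {xs x y} → label x ≡ label y → orbitRank xs x ≡ orbitRank xs y
  orbitRank-cong {xs} {x} {y} x~y =
    trans (rank-cong (orbit-cong x~y) (orbit-cong (sym x~y)) (label x))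
          (cong (rank (orbit xs y)) x~y)

  orbitRank-injective : ∀ {xs k x} → Stabilises xs k →
                        orbitRank xs (act k x) ≡ orbitRank xs x → label (act k x) ≡ label x
  orbitRank-injective {xs} {k} {x} k∈ eq =
    rank-injective (∈-orbit⁺ k∈) (orbit-self xs x)
      (trans (rank-cong (orbit-⊆-act k∈) (act-orbit-⊆ k∈) (label (act k x))) eq)

  LabelInvariant : ∀ {m} → (X → Fin m) → Set
  LabelInvariant c = ∀ {x y} → label x ≡ label y → c x ≡ c y

  DistinguishesStabiliser : ∀ {m} → List X → (X → Fin m) → Set
  DistinguishesStabiliser xs c = ∀ k → Stabilises xs k → Preserves A c k → k ≡ e

  Indistinguishable : List X → ℕ → Set
  Indistinguishable xs m = (c : X → Fin m) → LabelInvariant c → ¬ DistinguishesStabiliser xs c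

  Indistinguishable⇒largeOrbit : ∀ {xs m} → Indistinguishable xs m → ¬ ¬ ∃ λ x → m < orbitSize xs x
  Indistinguishable⇒largeOrbit {xs} {m} indist noLarge =
    indist colour colour-invariant colour-distinguishes
    where
    small : ∀ x → orbitRank xs x < m
    small x = <-≤-trans (orbitRank<orbitSize xs x) (≤-pred (≰⇒> λ large → noLarge (x , large)))
    colour : X → Fin m
    colour x = fromℕ< (small x)
    colour-invariant : LabelInvariant colour
    colour-invariant x~y = fromℕ<-cong _ _ (orbitRank-cong x~y) _ _
    colour-distinguishes : DistinguishesStabiliser xs colour
    colour-distinguishes k k∈ pres =
      label-faithful k λ x → orbitRank-injective k∈ (fromℕ<-injective _ _ _ _ (pres x))

  Indistinguishable-∷ : ∀ {xs m} x₀ → Indistinguishable xs (suc m) → Indistinguishable (x₀ ∷ xs) m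
  Indistinguishable-∷ {xs} x₀ indist c c-invariant c-distinguishes =
    indist c′ c′-invariant c′-distinguishes
    where
    mark : ∀ {m} {P : Set} → Dec P → Fin m → Fin (suc m)
    mark (yes _) _ = zero
    mark (no _)  j = suc j
    c′ : X → Fin _
    c′ x = mark (label x ≟ label x₀) (c x)
    c′-invariant : LabelInvariant c′
    c′-invariant x~y = cong₂ (λ n j → mark (n ≟ label x₀) j) x~y (c-invariant x~y)
    c′-distinguishes : DistinguishesStabiliser xs c′
    c′-distinguishes k k∈ pres = c-distinguishes k (kx₀~x₀ ∷ k∈) preserves
      where
      kx₀~x₀ : label (act k x₀) ≡ label x₀
      kx₀~x₀ with label (act k x₀) ≟ label x₀ | label x₀ ≟ label x₀ | pres x₀
      ... | yes eq | _      | _  = eq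
      ... | no _   | yes _  | ()
      ... | no _   | no neq | _  = ⊥-elim (neq refl)
      preserves : Preserves A c k
      preserves x with label (act k x) ≟ label x₀ | label x ≟ label x₀ | pres x
      ... | _      | yes x~x₀ | _  =
        c-invariant (trans (label-act k x~x₀) (trans kx₀~x₀ (sym x~x₀)))
      ... | yes _  | no _     | ()
      ... | no _   | no _     | eq = suc-injective eq

  -- Choosing g with label (g x₀) = v for each v in vs, the cosets g·L are disjoint.
  cosets : ∀ {x₀ xs L} → Unique L → All (Stabilises (x₀ ∷ xs)) L →
           (vs : List ℕ) → Unique vs → vs ⊆ orbit xs x₀ →
           Σ (List Carrier) λ M → Unique M × All (Stabilises xs) M ×
             All (λ g → label (act g x₀) ∈ vs) M × length M ≡ length vs * length L
  cosets _ _ [] _ _ = [] , [] , [] , [] , refl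
  cosets {x₀} {xs} {L} uL sL (v ∷ vs) uvs@(_ ∷ uvs′) vs⊆
    with g , g∈ , refl ← ∈-orbit⁻ (vs⊆ (here refl))
    with M , uM , sM , imM , |M| ← cosets uL sL vs uvs′ (vs⊆ ∘ there) =
      map (g ·_) L ++ M
    , Unique.++⁺ (Unique.map⁺ (·-cancelˡ {G} g) uL) uM disjoint
    , ++⁺ (map⁺ (All.map (λ k∈ → Stabilises-· g∈ (All.tail k∈)) sL)) sM
    , ++⁺ (map⁺ (All.map (λ k∈ → here (coset-label k∈)) sL)) (All.map there imM)
    , trans (length-++ (map (g ·_) L)) (cong₂ _+_ (length-map (g ·_) L) |M|)
    where
    coset-label : ∀ {k} → Stabilises (x₀ ∷ xs) k → label (act (g · k) x₀) ≡ label (act g x₀)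
    coset-label {k} (kx₀ ∷ _) = trans (cong label (act-· g k x₀)) (label-act g kx₀)
    disjoint : ∀ {h} → ¬ (h ∈ map (g ·_) L × h ∈ M)
    disjoint (h∈gL , h∈M) with k , k∈L , refl ← ∈-map⁻ _ h∈gL =
      Unique.Unique[x∷xs]⇒x∉xs uvs
        (subst (_∈ vs) (coset-label (All.lookup sL k∈L)) (All.lookup imM h∈M))

  orbit-stabiliser : ∀ {n} x₀ xs → AtLeast n (Stabilises (x₀ ∷ xs)) →
                     AtLeast (orbitSize xs x₀ * n) (Stabilises xs)
  orbit-stabiliser {n} x₀ xs (L , uL , sL , n≤|L|)
    with M , uM , sM , _ , |M| ←
      cosets uL sL (below (orbit xs x₀) bound) (below-Unique _ bound) (below-⊆ _ bound) =
    M , uM , sM , subst (_ ≤_) (sym |M|) (*-monoʳ-≤ (orbitSize xs x₀) n≤|L|)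

  Indistinguishable⇒AtLeast! : ∀ m xs → Indistinguishable xs m →
                               ¬ ¬ AtLeast (suc m !) (Stabilises xs)
  Indistinguishable⇒AtLeast! zero xs _ k = k ([ e ] , [] ∷ [] , Stabilises-e xs ∷ [] , ≤-refl)
  Indistinguishable⇒AtLeast! (suc m) xs indist k =
    Indistinguishable⇒largeOrbit indist λ (x₀ , large) →
    Indistinguishable⇒AtLeast! m (x₀ ∷ xs) (Indistinguishable-∷ x₀ indist) λ stab →
    k (AtLeast-≤ (*-monoˡ-≤ (suc m !) large) (orbit-stabiliser x₀ xs stab))

module _ {G : Grp} (elems : List (Grp.Carrier G)) (complete : ∀ g → g ∈ elems)
         {X : Set} (A : Action G X) where
  open Grp G
  open Action A

  profile : ∀ {D} → (X → Fin D) → X → ℕ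
  profile φ x = toℕ (funToFin (λ i → φ (act (lookup elems i) x)))

  module _ {D} (φ : X → Fin D) where

    profile-injective : ∀ {x y} → profile φ x ≡ profile φ y → ∀ h → φ (act h x) ≡ φ (act h y)
    profile-injective {x} {y} eq h =
      subst (λ g → φ (act g x) ≡ φ (act g y)) (sym (lookup-index (complete h)))
        (funToFin-injective (toℕ-injective eq) (index (complete h)))

    profile-act : ∀ g {x y} → profile φ x ≡ profile φ y → profile φ (act g x) ≡ profile φ (act g y)
    profile-act g {x} {y} eq = cong toℕ (funToFin-cong λ i → let h = lookup elems i in begin
      φ (act h (act g x)) ≡⟨ cong φ (act-· h g x) ⟨
      φ (act (h · g) x)   ≡⟨ profile-injective eq (h · g) ⟩
      φ (act (h · g) y)   ≡⟨ cong φ (act-· h g y) ⟩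
      φ (act h (act g y)) ∎)
      where open ≡-Reasoning

    profile-faithful : Distinguishes A φ → ∀ g → (∀ x → profile φ (act g x) ≡ profile φ x) → g ≡ e
    profile-faithful dist g fixes = dist g λ x → begin
      φ (act g x)         ≡⟨ cong φ (act-e (act g x)) ⟨
      φ (act e (act g x)) ≡⟨ profile-injective (fixes x) e ⟩
      φ (act e x)         ≡⟨ cong φ (act-e x) ⟩
      φ x                 ∎
      where open ≡-Reasoning

  IsDistNumber⇒AtLeast! : ∀ {D} → IsDistNumber A D → ¬ ¬ AtLeast {Carrier} (D !) U
  IsDistNumber⇒AtLeast! {zero} _ k = k ([ e ] , [] ∷ [] , tt ∷ [] , ≤-refl)
  IsDistNumber⇒AtLeast! {suc m} ((φ , _ , φ-dist) , minimal) =
    ¬¬-map (λ (L , uL , _ , |L|) → L , uL , All.universal-U L , |L|)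
      (Indistinguishable⇒AtLeast! m [] indist)
    where
    open Labelled elems complete A (profile φ) (suc m ^ length elems) (λ _ → toℕ<n _)
      (profile-act φ) (profile-faithful φ φ-dist)
    indist : Indistinguishable [] m
    indist c _ c-dist = noSmallDistinguishing A minimal ≤-refl c (λ k → c-dist k [])

module _ (Γ : FinGrp) (H : Subgroup (FinGrp.grp Γ)) where
  open FinGrp Γ
  open Subgroup H
  open Inverse enum

  private
    Member : Set
    Member = Grp.Carrier (subGrp grp H)

  members : List Member
  members = All.toList (all-filter (T? ∘ mem) (map from (allFin order)))

  ∈-members : ∀ g → g ∈ members
  ∈-members (g , g∈H) = ∈-toList⁺ T-irrelevant _ (∈-filter⁺ (T? ∘ mem) g∈ g∈H) g∈H
    where
    g∈ : g ∈ map from (allFin order)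
    g∈ = subst (_∈ _) (strictlyInverseʳ g) (∈-map⁺ from (∈-allFin (to g)))

  Unique⇒length≤subOrder : ∀ {L : List Member} → Unique L → length L ≤ subOrder Γ H
  Unique⇒length≤subOrder {L} uL = begin
    length L                ≡⟨ length-map position L ⟨
    length (map position L) ≤⟨ Unique-⊆⇒length≤ position-Unique position∈ ⟩
    length inH              ≡⟨ sum-indicator≡length-filter (mem ∘ from) (allFin order) ⟨
    subOrder Γ H            ∎
    where
    open ≤-Reasoning
    position : Member → Fin order
    position = to ∘ proj₁
    position-injective : ∀ {a b} → position a ≡ position b → a ≡ b
    position-injective {g , p} {h , q} eq
      with refl ← trans (sym (strictlyInverseʳ g)) (trans (cong from eq) (strictlyInverseʳ h)) =
      cong (g ,_) (T-irrelevant p q)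
    position-Unique : Unique (map position L)
    position-Unique = Unique.map⁺ position-injective uL
    inH : List (Fin order)
    inH = filter (T? ∘ mem ∘ from) (allFin order)
    position∈ : map position L ⊆ inH
    position∈ i∈ with (g , g∈H) , _ , refl ← ∈-map⁻ position i∈ =
      ∈-filter⁺ (T? ∘ mem ∘ from) (∈-allFin (to g)) (subst (T ∘ mem) (sym (strictlyInverseʳ g)) g∈H)

  IsDistNumber⇒!≤subOrder : ∀ {X} (A : Action (subGrp grp H) X) {r} → IsDistNumber A r →
                            ¬ ¬ (r ! ≤ subOrder Γ H)
  IsDistNumber⇒!≤subOrder A isDist =
    ¬¬-map (λ (L , uL , _ , r!≤|L|) → ≤-trans r!≤|L| (Unique⇒length≤subOrder uL))
      (IsDistNumber⇒AtLeast! members ∈-members A isDist)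

mainTheorem10 : (Γ : FinGrp) (t : ℕ) → 1 ≤ t →
    (d : ℕ) → IsMaxDistNumber (FinGrp.grp Γ) d →
    FinGrp.order Γ ≤ t * (d !) →
    (H : Subgroup (FinGrp.grp Γ)) → IndexAtLeast Γ H t →
    (dH : ℕ) → IsMaxDistNumber (subGrp (FinGrp.grp Γ) H) dH →
    dH ≤ d
mainTheorem10 Γ t 1≤t d maxΓ ord H idx dH ((_ , A , _ , isDistH) , _) =
  decidable-stable (dH ≤? d) (¬¬-map bound (IsDistNumber⇒!≤subOrder Γ H A isDistH))
  where
  open ≤-Reasoning
  bound : dH ! ≤ subOrder Γ H → dH ≤ d
  bound dH!≤|H| = ≮⇒≥ λ d<dH → <⇒≱ (!-mono-< (maxDistNumber-positive maxΓ) d<dH)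
    (*-cancelˡ-≤ t {{>-nonZero 1≤t}} (begin
      t * dH !          ≤⟨ *-monoʳ-≤ t dH!≤|H| ⟩
      t * subOrder Γ H  ≤⟨ idx ⟩
      FinGrp.order Γ    ≤⟨ ord ⟩
      t * d !           ∎))
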